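{- Let $(a_{n,m})$ be the numbers determined by $a_{0,0}=1$, $a_{n,n}=0$ for $n\ge1$, $a_{n,0}=a_{n-1,0}+a_{n,1}$ for $n\ge 1$, and $a_{n,m}=a_{n-1,m-1}+a_{n,m+1}$ for $1\le m\le n-1$, extended by $a_{i,j}=0$ for $j>i$. Then the generating function $G(x,y)=\sum_{i\ge0}\sum_{j\ge0}a_{i,j}x^iy^j$ is $$G(x,y)=\frac{(1-xy)\left(1-\sqrt{1-4x}-2xy\right)}{2x\,(1-y+xy^2)}.$$
   Context: The identity is one of formal power series (equivalently of analytic functions near the origin, with $\frac{1-\sqrt{1-4x}}{2x}$ the Catalan generating function). -}

module Defs where

open import Data.Nat using (ℕ; zero; suc; _∸_; _≡ᵇ_)
open import Data.Integer using (ℤ; +_; _+_; _*_; _-_; 0ℤ; 1ℤ)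
open import Data.Product using (_×_)
open import Data.Bool using (if_then_else_; _∧_)
open import Relation.Binary.PropositionalEquality using (_≡_)

-- Formal power series in two variables x, y over ℤ:
-- F i j is the coefficient of x^i y^j.
PS2 : Set
PS2 = ℕ → ℕ → ℤ

sumTo : ℕ → (ℕ → ℤ) → ℤ
sumTo zero    f = f 0
sumTo (suc n) f = sumTo n f + f (suc n)

_⊛_ : PS2 → PS2 → PS2
(F ⊛ G) i j = sumTo i λ p → sumTo j λ q → F p q * G (i ∸ p) (j ∸ q)

_⊕_ : PS2 → PS2 → PS2
(F ⊕ G) i j = F i j + G i j

_⊖_ : PS2 → PS2 → PS2
(F ⊖ G) i j = F i j - G i j

infixl 7 _⊛_
infixl 6 _⊕_ _⊖_

mono : ℤ → ℕ → ℕ → PS2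
mono c a b i j = if (i ≡ᵇ a) ∧ (j ≡ᵇ b) then c else 0ℤ

fromX : (ℕ → ℤ) → PS2
fromX s i j = if j ≡ᵇ 0 then s i else 0ℤ

_≈_ : PS2 → PS2 → Set
F ≈ G = ∀ i j → F i j ≡ G i j

infix 4 _≈_

IsSqrt1m4x : (ℕ → ℤ) → Set
IsSqrt1m4x S = (S 0 ≡ 1ℤ) × (fromX S ⊛ fromX S ≈ mono 1ℤ 0 0 ⊖ mono (+ 4) 1 0)

-- numerator (1 - xy)(1 - S - 2xy)  and denominator 2x(1 - y + x y^2)
numer : (ℕ → ℤ) → PS2
numer S = (mono 1ℤ 0 0 ⊖ mono 1ℤ 1 1) ⊛ (mono 1ℤ 0 0 ⊖ fromX S ⊖ mono (+ 2) 1 1)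

denom : PS2
denom = mono (+ 2) 1 0 ⊖ mono (+ 2) 1 1 ⊕ mono (+ 2) 2 2

module Submission where

-- The array a is the Catalan triangle, and the theorem is its bivariate
-- generating function.  Everything is proved coefficientwise.
--
-- With S = 1 - 2x·A the identity a ⊛ denom ≈ numer S is then a finite
--    case check of the recurrences (coefficients).
-- The theorem takes T = 1 - 2x·A as the root, and any other root equals T.

open import Defs
open import Data.Nat using (ℕ; zero; suc; _<_; _≤_; _∸_; _≡ᵇ_; z≤n; s≤s)
import Data.Nat as ℕ
open import Data.Nat.Properties
  using ( ≤-refl; ≤-trans; ≤-<-trans; n≤1+n; m∸n≤m; n∸n≡0; m∸[m∸n]≡n; +-∸-assoc; +-suc
        ; m≤m+n; <-cmp )
open import Data.Nat.Induction using (<-rec)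
open import Data.Integer using (ℤ; +_; _+_; _*_; _-_; -_; 0ℤ; 1ℤ)
open import Data.Integer.Properties
  using ( +-identityˡ; +-identityʳ; +-assoc; +-comm; *-zeroʳ; *-identityˡ; *-identityʳ; *-comm
        ; *-distribˡ-+; *-distribʳ-+; neg-distrib-+; neg-distribˡ-*; *-cancelˡ-≡
        ; +-commutativeSemigroup; +-0-abelianGroup )
open import Data.Integer.Tactic.RingSolver using (solve-∀)
open import Algebra.Bundles using (AbelianGroup)
open import Algebra.Properties.CommutativeSemigroup +-commutativeSemigroup using (interchange)
open import Algebra.Properties.Group (AbelianGroup.group +-0-abelianGroup) using (∙-cancelʳ)
open import Data.Bool using (true; false; if_then_else_)
open import Data.Bool.Properties using (∧-zeroʳ)
open import Data.Product using (_×_; _,_; proj₂; ∃)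
open import Function using (_∘_)
open import Relation.Binary using (tri<; tri≈; tri>)
open import Relation.Binary.PropositionalEquality
  using (_≡_; refl; sym; trans; cong; cong₂; subst; module ≡-Reasoning)
open ≡-Reasoning

sumTo-cong : ∀ n {f g : ℕ → ℤ} → (∀ k → k ≤ n → f k ≡ g k) → sumTo n f ≡ sumTo n g
sumTo-cong zero    f≡g = f≡g 0 z≤n
sumTo-cong (suc n) f≡g =
  cong₂ _+_ (sumTo-cong n (λ k k≤n → f≡g k (≤-trans k≤n (n≤1+n n)))) (f≡g (suc n) ≤-refl)

sumTo-zero : ∀ n {f : ℕ → ℤ} → (∀ k → k ≤ n → f k ≡ 0ℤ) → sumTo n f ≡ 0ℤ
sumTo-zero zero    f≡0 = f≡0 0 z≤n
sumTo-zero (suc n) f≡0 =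
  cong₂ _+_ (sumTo-zero n (λ k k≤n → f≡0 k (≤-trans k≤n (n≤1+n n)))) (f≡0 (suc n) ≤-refl)

sumTo-+ : ∀ n (f g : ℕ → ℤ) → sumTo n (λ k → f k + g k) ≡ sumTo n f + sumTo n g
sumTo-+ zero    f g = refl
sumTo-+ (suc n) f g = begin
  sumTo n (λ k → f k + g k) + (f (suc n) + g (suc n))
    ≡⟨ cong (_+ (f (suc n) + g (suc n))) (sumTo-+ n f g) ⟩
  (sumTo n f + sumTo n g) + (f (suc n) + g (suc n))
    ≡⟨ interchange (sumTo n f) (sumTo n g) (f (suc n)) (g (suc n)) ⟩
  sumTo (suc n) f + sumTo (suc n) g ∎

sumTo-neg : ∀ n (f : ℕ → ℤ) → sumTo n (λ k → - f k) ≡ - sumTo n f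
sumTo-neg zero    f = refl
sumTo-neg (suc n) f = begin
  sumTo n (λ k → - f k) + - f (suc n) ≡⟨ cong (_+ - f (suc n)) (sumTo-neg n f) ⟩
  - sumTo n f + - f (suc n)           ≡⟨ sym (neg-distrib-+ (sumTo n f) (f (suc n))) ⟩
  - sumTo (suc n) f ∎

sumTo-- : ∀ n (f g : ℕ → ℤ) → sumTo n (λ k → f k - g k) ≡ sumTo n f - sumTo n g
sumTo-- n f g = trans (sumTo-+ n f (λ k → - g k)) (cong (λ t → sumTo n f + t) (sumTo-neg n g))

sumTo-*ˡ : ∀ n c (f : ℕ → ℤ) → sumTo n (λ k → c * f k) ≡ c * sumTo n f
sumTo-*ˡ zero    c f = refl
sumTo-*ˡ (suc n) c f = begin
  sumTo n (λ k → c * f k) + c * f (suc n) ≡⟨ cong (_+ c * f (suc n)) (sumTo-*ˡ n c f) ⟩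
  c * sumTo n f + c * f (suc n)           ≡⟨ sym (*-distribˡ-+ c (sumTo n f) (f (suc n))) ⟩
  c * sumTo (suc n) f ∎

sumTo-shift : ∀ n (f : ℕ → ℤ) → sumTo (suc n) f ≡ f 0 + sumTo n (f ∘ suc)
sumTo-shift zero    f = refl
sumTo-shift (suc n) f = begin
  sumTo (suc n) f + f (suc (suc n))
    ≡⟨ cong (_+ f (suc (suc n))) (sumTo-shift n f) ⟩
  (f 0 + sumTo n (f ∘ suc)) + f (suc (suc n))
    ≡⟨ +-assoc (f 0) (sumTo n (f ∘ suc)) (f (suc (suc n))) ⟩
  f 0 + sumTo (suc n) (f ∘ suc) ∎

-- Reindexing k ↦ n - k; this is what makes ⊛ commutative.
sumTo-reverse : ∀ n (f : ℕ → ℤ) → sumTo n f ≡ sumTo n (λ k → f (n ∸ k))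
sumTo-reverse zero    f = refl
sumTo-reverse (suc n) f = begin
  sumTo n f + f (suc n)                 ≡⟨ cong (_+ f (suc n)) (sumTo-reverse n f) ⟩
  sumTo n (λ k → f (n ∸ k)) + f (suc n) ≡⟨ +-comm (sumTo n (λ k → f (n ∸ k))) (f (suc n)) ⟩
  f (suc n) + sumTo n (λ k → f (n ∸ k)) ≡⟨ sym (sumTo-shift n (λ k → f (suc n ∸ k))) ⟩
  sumTo (suc n) (λ k → f (suc n ∸ k)) ∎

-- Convolution of univariate sequences: the coefficients of the product of
-- two series in x.  On series in x alone, ⊛ is cv in row 0.
cv : (ℕ → ℤ) → (ℕ → ℤ) → ℕ → ℤ
cv f g n = sumTo n (λ k → f k * g (n ∸ k))

cv-cong : ∀ n {f f′ g g′ : ℕ → ℤ} →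
          (∀ k → k ≤ n → f k ≡ f′ k) → (∀ k → k ≤ n → g k ≡ g′ k) → cv f g n ≡ cv f′ g′ n
cv-cong n f≡ g≡ = sumTo-cong n (λ k k≤n → cong₂ _*_ (f≡ k k≤n) (g≡ (n ∸ k) (m∸n≤m n k)))

cv-congʳ : ∀ n (f : ℕ → ℤ) {g g′ : ℕ → ℤ} →
           (∀ k → k ≤ n → g k ≡ g′ k) → cv f g n ≡ cv f g′ n
cv-congʳ n f = cv-cong n {f = f} {f′ = f} (λ _ _ → refl)

cv-peelFirst : ∀ n (f g : ℕ → ℤ) → cv f g (suc n) ≡ f 0 * g (suc n) + cv (f ∘ suc) g n
cv-peelFirst n f g = sumTo-shift n (λ k → f k * g (suc n ∸ k))

cv-peelLast : ∀ n (f g : ℕ → ℤ) → cv f g (suc n) ≡ cv f (g ∘ suc) n + f (suc n) * g 0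
cv-peelLast n f g =
  cong₂ _+_ (sumTo-cong n (λ k k≤n → cong (λ t → f k * g t) (+-∸-assoc 1 k≤n)))
            (cong (λ t → f (suc n) * g t) (n∸n≡0 n))

cv-+ʳ : ∀ n (f g h : ℕ → ℤ) → cv f (λ p → g p + h p) n ≡ cv f g n + cv f h n
cv-+ʳ n f g h =
  trans (sumTo-cong n (λ k _ → *-distribˡ-+ (f k) (g (n ∸ k)) (h (n ∸ k)))) (sumTo-+ n _ _)

cv-zeroʳ : ∀ n (f : ℕ → ℤ) → cv f (λ _ → 0ℤ) n ≡ 0ℤ
cv-zeroʳ n f = sumTo-zero n (λ k _ → *-zeroʳ (f k))

cv-scale : ∀ n c d (f g : ℕ → ℤ) → cv (λ k → c * f k) (λ k → d * g k) n ≡ (c * d) * cv f g n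
cv-scale n c d f g =
  trans (sumTo-cong n (λ k _ → regroup c d (f k) (g (n ∸ k)))) (sumTo-*ˡ n (c * d) _)
  where
  regroup : ∀ c d x y → (c * x) * (d * y) ≡ (c * d) * (x * y)
  regroup = solve-∀

δ : PS2
δ p (suc m)    = 0ℤ
δ zero zero    = 1ℤ
δ (suc p) zero = 0ℤ

cv-unitʳ : ∀ n (f : ℕ → ℤ) → cv f (λ p → δ p 0) n ≡ f n
cv-unitʳ zero    f = *-identityʳ (f 0)
cv-unitʳ (suc n) f = begin
  cv f (λ p → δ p 0) (suc n)            ≡⟨ cv-peelLast n f (λ p → δ p 0) ⟩
  cv f (λ _ → 0ℤ) n + f (suc n) * 1ℤ    ≡⟨ cong₂ _+_ (cv-zeroʳ n f) (*-identityʳ (f (suc n))) ⟩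
  0ℤ + f (suc n)                        ≡⟨ +-identityˡ (f (suc n)) ⟩
  f (suc n) ∎

oneMinusTwoX : (ℕ → ℤ) → ℕ → ℤ
oneMinusTwoX C zero    = 1ℤ
oneMinusTwoX C (suc n) = - (+ 2) * C n

-- The part of (f·f)ₙ₊₁ involving neither f₀ nor fₙ₊₁; it depends only on
-- f₁, …, fₙ (cvInterior-cong).
cvInterior : (ℕ → ℤ) → ℕ → ℤ
cvInterior f zero    = 0ℤ
cvInterior f (suc m) = cv (f ∘ suc) (f ∘ suc) m

cvInterior-cong : ∀ n {f g : ℕ → ℤ} → (∀ k → k ≤ n → f k ≡ g k) → cvInterior f n ≡ cvInterior g n
cvInterior-cong zero    f≡g = refl
cvInterior-cong (suc m) {f} {g} f≡g = cv-cong m f≡g₊ f≡g₊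
  where
  f≡g₊ : ∀ k → k ≤ m → f (suc k) ≡ g (suc k)
  f≡g₊ k k≤m = f≡g (suc k) (s≤s k≤m)

cv-square-split : ∀ (f : ℕ → ℤ) → f 0 ≡ 1ℤ →
                  ∀ n → cv f f (suc n) ≡ (f (suc n) + f (suc n)) + cvInterior f n
cv-square-split f f₀≡1 zero = begin
  f 0 * f 1 + f 1 * f 0    ≡⟨ cong (λ c → c * f 1 + f 1 * c) f₀≡1 ⟩
  1ℤ * f 1 + f 1 * 1ℤ      ≡⟨ ends (f 1) ⟩
  (f 1 + f 1) + 0ℤ ∎
  where
  ends : ∀ x → 1ℤ * x + x * 1ℤ ≡ (x + x) + 0ℤ
  ends = solve-∀
cv-square-split f f₀≡1 (suc m) = begin
  cv f f (suc (suc m))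
    ≡⟨ cv-peelFirst (suc m) f f ⟩
  f 0 * x + cv (f ∘ suc) f (suc m)
    ≡⟨ cong (λ t → f 0 * x + t) (cv-peelLast m (f ∘ suc) f) ⟩
  f 0 * x + (cvInterior f (suc m) + x * f 0)
    ≡⟨ cong (λ c → c * x + (cvInterior f (suc m) + x * c)) f₀≡1 ⟩
  1ℤ * x + (cvInterior f (suc m) + x * 1ℤ)
    ≡⟨ ends x (cvInterior f (suc m)) ⟩
  (x + x) + cvInterior f (suc m) ∎
  where
  x : ℤ
  x = f (suc (suc m))
  ends : ∀ x M → 1ℤ * x + (M + x * 1ℤ) ≡ (x + x) + M
  ends = solve-∀

double-injective : ∀ x y → x + x ≡ y + y → x ≡ y
double-injective x y x+x≡y+y =
  *-cancelˡ-≡ (+ 2) x y (trans (twice x) (trans x+x≡y+y (sym (twice y))))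
  where
  twice : ∀ x → + 2 * x ≡ x + x
  twice = solve-∀

-- A series with constant term 1 is determined by its square: by the split
-- above, (f·f)ₙ₊₁ determines 2fₙ₊₁ once f₀, …, fₙ are known.
square-root-unique : ∀ (f g : ℕ → ℤ) → f 0 ≡ 1ℤ → g 0 ≡ 1ℤ →
                     (∀ n → cv f f n ≡ cv g g n) → ∀ n → f n ≡ g n
square-root-unique f g f₀≡1 g₀≡1 f²≡g² = <-rec (λ n → f n ≡ g n) agree
  where
  agree : ∀ n → (∀ {k} → k < n → f k ≡ g k) → f n ≡ g n
  agree zero    _  = trans f₀≡1 (sym g₀≡1)
  agree (suc n) ih = double-injective (f (suc n)) (g (suc n)) (∙-cancelʳ (cvInterior g n) _ _ (begin
    (f (suc n) + f (suc n)) + cvInterior g n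
      ≡⟨ cong (λ t → (f (suc n) + f (suc n)) + t) (sym (cvInterior-cong n (λ k k≤n → ih (s≤s k≤n)))) ⟩
    (f (suc n) + f (suc n)) + cvInterior f n
      ≡⟨ sym (cv-square-split f f₀≡1 n) ⟩
    cv f f (suc n)
      ≡⟨ f²≡g² (suc n) ⟩
    cv g g (suc n)
      ≡⟨ cv-square-split g g₀≡1 n ⟩
    (g (suc n) + g (suc n)) + cvInterior g n ∎))

fromX-⊛-suc : ∀ (f g : ℕ → ℤ) i j → (fromX f ⊛ fromX g) i (suc j) ≡ 0ℤ
fromX-⊛-suc f g i j = sumTo-zero i (λ p _ →
  trans (sumTo-shift j _) (cong₂ _+_ (*-zeroʳ (f p)) (sumTo-zero j (λ _ _ → refl))))

oneMinusFourX-suc : ∀ i j → (mono 1ℤ 0 0 ⊖ mono (+ 4) 1 0) i (suc j) ≡ 0ℤ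
oneMinusFourX-suc zero          j = refl
oneMinusFourX-suc (suc zero)    j = refl
oneMinusFourX-suc (suc (suc i)) j = refl

-- If C₀ = 1 and Cₙ₊₁ = (C·C)ₙ (the Catalan recurrence), then 1 - 2x·C(x)
-- squares to 1 - 4x:  (1 - 2xC)² = 1 - 4x(C - xC²) = 1 - 4x.
catalan-sqrt : ∀ (C : ℕ → ℤ) → C 0 ≡ 1ℤ → (∀ n → C (suc n) ≡ cv C C n) →
               IsSqrt1m4x (oneMinusTwoX C)
catalan-sqrt C C₀≡1 C-rec = refl , square
  where
  T : ℕ → ℤ
  T = oneMinusTwoX C
  square-x : ∀ n → cv T T n ≡ (mono 1ℤ 0 0 ⊖ mono (+ 4) 1 0) n 0
  square-x zero = refl
  square-x (suc zero) = begin
    cv T T 1                                   ≡⟨ cv-square-split T refl 0 ⟩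
    (- (+ 2) * C 0 + - (+ 2) * C 0) + 0ℤ       ≡⟨ cong (λ c → (- (+ 2) * c + - (+ 2) * c) + 0ℤ) C₀≡1 ⟩
    0ℤ - + 4 ∎
  square-x (suc (suc m)) = begin
    cv T T (suc (suc m))
      ≡⟨ cv-square-split T refl (suc m) ⟩
    (- (+ 2) * C (suc m) + - (+ 2) * C (suc m)) + cv (T ∘ suc) (T ∘ suc) m
      ≡⟨ cong (λ t → (- (+ 2) * C (suc m) + - (+ 2) * C (suc m)) + t) (cv-scale m (- (+ 2)) (- (+ 2)) C C) ⟩
    (- (+ 2) * C (suc m) + - (+ 2) * C (suc m)) + (- (+ 2) * - (+ 2)) * cv C C m
      ≡⟨ cong (λ t → (- (+ 2) * C (suc m) + - (+ 2) * C (suc m)) + (- (+ 2) * - (+ 2)) * t) (sym (C-rec m)) ⟩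
    (- (+ 2) * C (suc m) + - (+ 2) * C (suc m)) + (- (+ 2) * - (+ 2)) * C (suc m)
      ≡⟨ cancels (C (suc m)) ⟩
    0ℤ ∎
    where
    cancels : ∀ x → (- (+ 2) * x + - (+ 2) * x) + (- (+ 2) * - (+ 2)) * x ≡ 0ℤ
    cancels = solve-∀
  square : fromX T ⊛ fromX T ≈ mono 1ℤ 0 0 ⊖ mono (+ 4) 1 0
  square i zero    = square-x i
  square i (suc j) = trans (fromX-⊛-suc T T i j) (sym (oneMinusFourX-suc i j))

shift : ℕ → (ℕ → ℤ) → ℕ → ℤ
shift zero    h i       = h i
shift (suc a) h zero    = 0ℤ
shift (suc a) h (suc i) = shift a h i

shift₂ : ℕ → ℕ → PS2 → PS2
shift₂ a b F i j = shift a (λ p → shift b (F p) j) i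

sumTo-select : ∀ n a (g : ℕ → ℤ) → sumTo n (λ p → if p ≡ᵇ a then g (n ∸ p) else 0ℤ) ≡ shift a g n
sumTo-select zero    zero    g = refl
sumTo-select zero    (suc a) g = refl
sumTo-select (suc n) zero    g = begin
  sumTo (suc n) (λ p → if p ≡ᵇ 0 then g (suc n ∸ p) else 0ℤ)
    ≡⟨ sumTo-shift n _ ⟩
  g (suc n) + sumTo n (λ _ → 0ℤ)
    ≡⟨ cong (λ t → g (suc n) + t) (sumTo-zero n (λ _ _ → refl)) ⟩
  g (suc n) + 0ℤ
    ≡⟨ +-identityʳ (g (suc n)) ⟩
  g (suc n) ∎
sumTo-select (suc n) (suc a) g = begin
  sumTo (suc n) (λ p → if p ≡ᵇ suc a then g (suc n ∸ p) else 0ℤ)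
    ≡⟨ sumTo-shift n _ ⟩
  0ℤ + sumTo n (λ p → if p ≡ᵇ a then g (n ∸ p) else 0ℤ)
    ≡⟨ +-identityˡ _ ⟩
  sumTo n (λ p → if p ≡ᵇ a then g (n ∸ p) else 0ℤ)
    ≡⟨ sumTo-select n a g ⟩
  shift a g n ∎

mono-* : ∀ c a b p q u →
         mono c a b p q * u ≡ (if p ≡ᵇ a then (if q ≡ᵇ b then c * u else 0ℤ) else 0ℤ)
mono-* c a b p q u with p ≡ᵇ a | q ≡ᵇ b
... | false | _     = refl
... | true  | true  = refl
... | true  | false = refl

sumTo-if : ∀ b n (g : ℕ → ℤ) → sumTo n (λ q → if b then g q else 0ℤ) ≡ (if b then sumTo n g else 0ℤ)
sumTo-if true  n g = refl
sumTo-if false n g = sumTo-zero n (λ _ _ → refl)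

mono-⊛ : ∀ c a b F → mono c a b ⊛ F ≈ shift₂ a b (λ p q → c * F p q)
mono-⊛ c a b F i j = begin
  sumTo i (λ p → sumTo j (λ q → mono c a b p q * F (i ∸ p) (j ∸ q)))
    ≡⟨ sumTo-cong i (λ p _ → inner p) ⟩
  sumTo i (λ p → if p ≡ᵇ a then shift b (λ q → c * F (i ∸ p) q) j else 0ℤ)
    ≡⟨ sumTo-select i a (λ p → shift b (λ q → c * F p q) j) ⟩
  shift₂ a b (λ p q → c * F p q) i j ∎
  where
  inner : ∀ p → sumTo j (λ q → mono c a b p q * F (i ∸ p) (j ∸ q))
                ≡ (if p ≡ᵇ a then shift b (λ q → c * F (i ∸ p) q) j else 0ℤ)
  inner p = begin
    sumTo j (λ q → mono c a b p q * F (i ∸ p) (j ∸ q))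
      ≡⟨ sumTo-cong j (λ q _ → mono-* c a b p q (F (i ∸ p) (j ∸ q))) ⟩
    sumTo j (λ q → if p ≡ᵇ a then (if q ≡ᵇ b then c * F (i ∸ p) (j ∸ q) else 0ℤ) else 0ℤ)
      ≡⟨ sumTo-if (p ≡ᵇ a) j _ ⟩
    (if p ≡ᵇ a then sumTo j (λ q → if q ≡ᵇ b then c * F (i ∸ p) (j ∸ q) else 0ℤ) else 0ℤ)
      ≡⟨ cong (λ t → if p ≡ᵇ a then t else 0ℤ) (sumTo-select j b (λ q → c * F (i ∸ p) q)) ⟩
    (if p ≡ᵇ a then shift b (λ q → c * F (i ∸ p) q) j else 0ℤ) ∎

⊛-comm : ∀ F G → F ⊛ G ≈ G ⊛ F
⊛-comm F G i j = begin
  sumTo i (λ p → sumTo j (λ q → F p q * G (i ∸ p) (j ∸ q)))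
    ≡⟨ sumTo-reverse i _ ⟩
  sumTo i (λ p → sumTo j (λ q → F (i ∸ p) q * G (i ∸ (i ∸ p)) (j ∸ q)))
    ≡⟨ sumTo-cong i (λ p p≤i → trans (sumTo-reverse j _) (sumTo-cong j (λ q q≤j → swap p≤i q≤j))) ⟩
  sumTo i (λ p → sumTo j (λ q → G p q * F (i ∸ p) (j ∸ q))) ∎
  where
  swap : ∀ {p q} → p ≤ i → q ≤ j →
         F (i ∸ p) (j ∸ q) * G (i ∸ (i ∸ p)) (j ∸ (j ∸ q)) ≡ G p q * F (i ∸ p) (j ∸ q)
  swap {p} {q} p≤i q≤j =
    trans (cong₂ (λ s t → F (i ∸ p) (j ∸ q) * G s t) (m∸[m∸n]≡n p≤i) (m∸[m∸n]≡n q≤j))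
          (*-comm (F (i ∸ p) (j ∸ q)) (G p q))

⊛-distribʳ-⊕ : ∀ F G H → (G ⊕ H) ⊛ F ≈ G ⊛ F ⊕ H ⊛ F
⊛-distribʳ-⊕ F G H i j =
  trans (sumTo-cong i (λ p _ →
          trans (sumTo-cong j (λ q _ → *-distribʳ-+ (F (i ∸ p) (j ∸ q)) (G p q) (H p q)))
                (sumTo-+ j _ _)))
        (sumTo-+ i _ _)

⊛-distribʳ-⊖ : ∀ F G H → (G ⊖ H) ⊛ F ≈ G ⊛ F ⊖ H ⊛ F
⊛-distribʳ-⊖ F G H i j =
  trans (sumTo-cong i (λ p _ →
          trans (sumTo-cong j (λ q _ → distrib (F (i ∸ p) (j ∸ q)) (G p q) (H p q)))
                (sumTo-- j _ _)))
        (sumTo-- i _ _)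
  where
  distrib : ∀ x y z → (y - z) * x ≡ y * x - z * x
  distrib x y z = trans (*-distribʳ-+ x y (- z)) (cong (λ t → y * x + t) (sym (neg-distribˡ-* z x)))

denom-⊛ : ∀ F → denom ⊛ F ≈
          shift₂ 1 0 (λ p q → + 2 * F p q) ⊖ shift₂ 1 1 (λ p q → + 2 * F p q)
            ⊕ shift₂ 2 2 (λ p q → + 2 * F p q)
denom-⊛ F i j =
  trans (⊛-distribʳ-⊕ F (mono (+ 2) 1 0 ⊖ mono (+ 2) 1 1) (mono (+ 2) 2 2) i j)
        (cong₂ _+_ (trans (⊛-distribʳ-⊖ F (mono (+ 2) 1 0) (mono (+ 2) 1 1) i j)
                          (cong₂ _-_ (mono-⊛ (+ 2) 1 0 F i j) (mono-⊛ (+ 2) 1 1 F i j)))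
                   (mono-⊛ (+ 2) 2 2 F i j))

Y : (ℕ → ℤ) → PS2
Y S = mono 1ℤ 0 0 ⊖ fromX S ⊖ mono (+ 2) 1 1

numer-expand : ∀ S → numer S ≈ shift₂ 0 0 (λ p q → 1ℤ * Y S p q) ⊖ shift₂ 1 1 (λ p q → 1ℤ * Y S p q)
numer-expand S i j =
  trans (⊛-distribʳ-⊖ (Y S) (mono 1ℤ 0 0) (mono 1ℤ 1 1) i j)
        (cong₂ _-_ (mono-⊛ 1ℤ 0 0 (Y S) i j) (mono-⊛ 1ℤ 1 1 (Y S) i j))

mono-unit : ∀ c p m → mono c 0 0 p m ≡ c * δ p m
mono-unit c zero    zero    = sym (*-identityʳ c)
mono-unit c zero    (suc m) = sym (*-zeroʳ c)
mono-unit c (suc p) zero    = sym (*-zeroʳ c)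
mono-unit c (suc p) (suc m) = sym (*-zeroʳ c)

backward-unique : ∀ (u f g : ℕ → ℤ) N →
                  (∀ m → f m ≡ u m + f (suc m)) → (∀ m → g m ≡ u m + g (suc m)) →
                  (∀ m → N ≤ m → f m ≡ g m) → ∀ m → f m ≡ g m
backward-unique u f g N f-rec g-rec tail m = from N m (m≤m+n N m)
  where
  from : ∀ k m → N ≤ k ℕ.+ m → f m ≡ g m
  from zero    m N≤m   = tail m N≤m
  from (suc k) m N≤k+m = begin
    f m             ≡⟨ f-rec m ⟩
    u m + f (suc m) ≡⟨ cong (λ t → u m + t) (from k (suc m) (subst (N ≤_) (sym (+-suc k m)) N≤k+m)) ⟩
    u m + g (suc m) ≡⟨ sym (g-rec m) ⟩
    g m ∎

module CatalanArray
  (a : ℕ → ℕ → ℤ)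
  (corner : a 0 0 ≡ 1ℤ)
  (diagonal : ∀ n → a (suc n) (suc n) ≡ 0ℤ)
  (column₀ : ∀ n → a (suc n) 0 ≡ a n 0 + a (suc n) 1)
  (interior : ∀ n m → m < n → a (suc n) (suc m) ≡ a n m + a (suc n) (suc (suc m)))
  (above : ∀ i j → i < j → a i j ≡ 0ℤ)
  where

  -- From row 1 on, the interior recurrence holds in every column: on and
  -- above the diagonal all three entries vanish.
  row-recurrence⁺ : ∀ p m → a (suc (suc p)) (suc m) ≡ a (suc p) m + a (suc (suc p)) (suc (suc m))
  row-recurrence⁺ p m with <-cmp m (suc p)
  ... | tri< m<p _ _ = interior (suc p) m m<p
  ... | tri≈ _ refl _ =
    trans (diagonal (suc p)) (sym (cong₂ _+_ (diagonal p) (above (suc (suc p)) (suc (suc (suc p))) ≤-refl)))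
  ... | tri> _ _ p<m =
    trans (above (suc (suc p)) (suc m) (s≤s p<m))
          (sym (cong₂ _+_ (above (suc p) m p<m) (above (suc (suc p)) (suc (suc m)) (s≤s (≤-trans p<m (n≤1+n m))))))

  -- In every row, up to the unit correction at p = m = 0 (a₁₁ = 0 but a₀₀ = 1).
  row-recurrence : ∀ p m → a (suc p) (suc m) + δ p m ≡ a p m + a (suc p) (suc (suc m))
  row-recurrence zero zero =
    trans (cong (λ t → t + 1ℤ) (diagonal 0)) (sym (cong₂ _+_ corner (above 1 2 ≤-refl)))
  row-recurrence zero (suc m) =
    trans (cong (λ t → t + 0ℤ) (above 1 (suc (suc m)) (s≤s (s≤s z≤n))))
          (sym (cong₂ _+_ (above 0 (suc m) (s≤s z≤n)) (above 1 (suc (suc (suc m))) (s≤s (s≤s z≤n)))))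
  row-recurrence (suc p) zero    = trans (+-identityʳ _) (row-recurrence⁺ p zero)
  row-recurrence (suc p) (suc m) = trans (+-identityʳ _) (row-recurrence⁺ p (suc m))

  -- The first column, which turns out to be the Catalan sequence.
  A : ℕ → ℤ
  A n = a n 0

  column : ℕ → ℕ → ℤ
  column m p = a p m

  E : ℕ → ℕ → ℤ
  E n m = cv A (column m) n

  E-vanishes : ∀ n m → n < m → E n m ≡ 0ℤ
  E-vanishes n m n<m = sumTo-zero n (λ k _ →
    trans (cong (A k *_) (above (n ∸ k) m (≤-<-trans (m∸n≤m n k) n<m))) (*-zeroʳ (A k)))

  -- Row 0 of column m + 1 vanishes, so only the rows below it contribute.
  E-peel : ∀ n m → E (suc n) (suc m) ≡ cv A (column (suc m) ∘ suc) n
  E-peel n m = begin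
    E (suc n) (suc m)                 ≡⟨ cv-peelLast n A (column (suc m)) ⟩
    shifted + A (suc n) * a 0 (suc m) ≡⟨ cong (λ t → shifted + A (suc n) * t) (above 0 (suc m) (s≤s z≤n)) ⟩
    shifted + A (suc n) * 0ℤ          ≡⟨ cong (λ t → shifted + t) (*-zeroʳ (A (suc n))) ⟩
    shifted + 0ℤ                      ≡⟨ +-identityʳ shifted ⟩
    shifted ∎
    where
    shifted : ℤ
    shifted = cv A (column (suc m) ∘ suc) n

  -- The unit correction convolved with A: Aₙ in column 0, nothing elsewhere.
  unitTerm : ℕ → ℕ → ℤ
  unitTerm n m = cv A (λ p → δ p m) n

  -- Convolving the row recurrence with A: E obeys the same recurrence as a.
  E-step : ∀ n m → E (suc n) (suc m) + unitTerm n m ≡ E n m + E (suc n) (suc (suc m))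
  E-step n m = begin
    E (suc n) (suc m) + unitTerm n m
      ≡⟨ cong (λ t → t + unitTerm n m) (E-peel n m) ⟩
    cv A (λ p → a (suc p) (suc m)) n + cv A (λ p → δ p m) n
      ≡⟨ sym (cv-+ʳ n A (λ p → a (suc p) (suc m)) (λ p → δ p m)) ⟩
    cv A (λ p → a (suc p) (suc m) + δ p m) n
      ≡⟨ cv-congʳ n A (λ p _ → row-recurrence p m) ⟩
    cv A (λ p → a p m + a (suc p) (suc (suc m))) n
      ≡⟨ cv-+ʳ n A (column m) (λ p → a (suc p) (suc (suc m))) ⟩
    E n m + cv A (λ p → a (suc p) (suc (suc m))) n
      ≡⟨ cong (λ t → E n m + t) (sym (E-peel n (suc m))) ⟩
    E n m + E (suc n) (suc (suc m)) ∎

  E-step₀ : ∀ n → E (suc n) 0 ≡ (E n 0 + E (suc n) 1) + A (suc n)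
  E-step₀ n = begin
    E (suc n) 0
      ≡⟨ cv-peelLast n A A ⟩
    cv A (A ∘ suc) n + A (suc n) * A 0
      ≡⟨ cong₂ _+_ (cv-congʳ n A (λ p _ → column₀ p))
                   (trans (cong (λ t → A (suc n) * t) corner) (*-identityʳ (A (suc n)))) ⟩
    cv A (λ p → a p 0 + a (suc p) 1) n + A (suc n)
      ≡⟨ cong (λ t → t + A (suc n)) (cv-+ʳ n A A (column 1 ∘ suc)) ⟩
    (E n 0 + cv A (column 1 ∘ suc) n) + A (suc n)
      ≡⟨ cong (λ t → (E n 0 + t) + A (suc n)) (sym (E-peel n 0)) ⟩
    (E n 0 + E (suc n) 1) + A (suc n) ∎

  -- If row n of E is row n + 1 of a shifted one column left (up to the unit
  -- term), the same holds for columns ≥ 1 of row n + 1: both sides solve the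
  -- backward recurrence in m given by row n + 1 of a, and both vanish above
  -- the diagonal.
  next-columns : ∀ n → (∀ m → E n m ≡ a (suc n) (suc m) + unitTerm n m) →
                 ∀ m → E (suc n) (suc m) ≡ a (suc (suc n)) (suc (suc m))
  next-columns n previous = backward-unique u f g (suc n) f-rec g-rec tail
    where
    u f g : ℕ → ℤ
    u m = a (suc n) (suc m)
    f m = E (suc n) (suc m)
    g m = a (suc (suc n)) (suc (suc m))
    rearrange : ∀ x d y → (x + d) + y ≡ (x + y) + d
    rearrange = solve-∀
    f-rec : ∀ m → f m ≡ u m + f (suc m)
    f-rec m = ∙-cancelʳ (unitTerm n m) (f m) (u m + f (suc m)) (begin
      f m + unitTerm n m               ≡⟨ E-step n m ⟩
      E n m + f (suc m)         ≡⟨ cong (λ t → t + f (suc m)) (previous m) ⟩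
      (u m + unitTerm n m) + f (suc m) ≡⟨ rearrange (u m) (unitTerm n m) (f (suc m)) ⟩
      (u m + f (suc m)) + unitTerm n m ∎)
    g-rec : ∀ m → g m ≡ u m + g (suc m)
    g-rec m = row-recurrence⁺ n (suc m)
    tail : ∀ m → suc n ≤ m → f m ≡ g m
    tail m n<m = trans (E-vanishes (suc n) (suc m) (s≤s n<m)) (sym (above _ _ (s≤s (s≤s n<m))))

  E-columns : ∀ n m → E n m ≡ a (suc n) (suc m) + unitTerm n m
  E-columns zero m = begin
    A 0 * a 0 m                    ≡⟨ cong (λ t → t * a 0 m) corner ⟩
    1ℤ * a 0 m                     ≡⟨ *-identityˡ (a 0 m) ⟩
    a 0 m                          ≡⟨ sym (+-identityʳ (a 0 m)) ⟩
    a 0 m + 0ℤ                     ≡⟨ cong (λ t → a 0 m + t) (sym (above 1 (suc (suc m)) (s≤s (s≤s z≤n)))) ⟩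
    a 0 m + a 1 (suc (suc m))      ≡⟨ sym (row-recurrence 0 m) ⟩
    a 1 (suc m) + δ 0 m            ≡⟨ cong (λ t → a 1 (suc m) + t) (sym (*-identityˡ (δ 0 m))) ⟩
    a 1 (suc m) + 1ℤ * δ 0 m       ≡⟨ cong (λ t → a 1 (suc m) + t * δ 0 m) (sym corner) ⟩
    a 1 (suc m) + A 0 * δ 0 m ∎
  E-columns (suc n) (suc m) = begin
    E (suc n) (suc m)                     ≡⟨ next-columns n (E-columns n) m ⟩
    a (suc (suc n)) (suc (suc m))         ≡⟨ sym (+-identityʳ _) ⟩
    a (suc (suc n)) (suc (suc m)) + 0ℤ
      ≡⟨ cong (λ t → a (suc (suc n)) (suc (suc m)) + t) (sym (cv-zeroʳ (suc n) A)) ⟩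
    a (suc (suc n)) (suc (suc m)) + unitTerm (suc n) (suc m) ∎
  E-columns (suc n) zero = begin
    E (suc n) 0
      ≡⟨ E-step₀ n ⟩
    (E n 0 + E (suc n) 1) + A (suc n)
      ≡⟨ cong₂ (λ s t → (s + t) + A (suc n)) (E-columns n 0) (next-columns n (E-columns n) 0) ⟩
    ((a (suc n) 1 + unitTerm n 0) + a (suc (suc n)) 2) + A (suc n)
      ≡⟨ cong (λ t → ((a (suc n) 1 + t) + a (suc (suc n)) 2) + A (suc n)) (cv-unitʳ n A) ⟩
    ((a (suc n) 1 + A n) + a (suc (suc n)) 2) + A (suc n)
      ≡⟨ cong (λ t → (t + a (suc (suc n)) 2) + A (suc n)) (trans (+-comm (a (suc n) 1) (A n)) (sym (column₀ n))) ⟩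
    (a (suc n) 0 + a (suc (suc n)) 2) + A (suc n)
      ≡⟨ cong (λ t → t + A (suc n)) (sym (row-recurrence⁺ n 0)) ⟩
    a (suc (suc n)) 1 + A (suc n)
      ≡⟨ cong (λ t → a (suc (suc n)) 1 + t) (sym (cv-unitʳ (suc n) A)) ⟩
    a (suc (suc n)) 1 + unitTerm (suc n) 0 ∎

  catalan : ∀ n → A (suc n) ≡ cv A A n
  catalan n = begin
    A (suc n)            ≡⟨ column₀ n ⟩
    A n + a (suc n) 1    ≡⟨ +-comm (A n) (a (suc n) 1) ⟩
    a (suc n) 1 + A n    ≡⟨ cong (λ t → a (suc n) 1 + t) (sym (cv-unitʳ n A)) ⟩
    a (suc n) 1 + unitTerm n 0  ≡⟨ sym (E-columns n 0) ⟩
    cv A A n ∎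

  T : ℕ → ℤ
  T = oneMinusTwoX A

  twoA : PS2
  twoA p q = + 2 * a p q

  -- Column 0 of the identity:  2a_{i,0} = -S_{i+1}  with  S_{i+1} = -2A_i.
  first-column : ∀ x → (+ 2 * x - 0ℤ) + 0ℤ ≡ 1ℤ * ((0ℤ - - (+ 2) * x) - 0ℤ) - 0ℤ
  first-column = solve-∀

  -- Each case is
  -- one of the recurrences: S = 1 - 2xA in column 0, the column-0 recurrence
  -- in column 1, the row recurrence (whose unit correction matches the -2xy
  -- of Y) in columns ≥ 2; rows 0 and 1 are boundary values.  (In column 1,
  -- ∧-zeroʳ records that the -2xy term of Y has no coefficient in column 0.)
  coefficients : ∀ S → (∀ n → S n ≡ T n) →
                 shift₂ 1 0 twoA ⊖ shift₂ 1 1 twoA ⊕ shift₂ 2 2 twoA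
                   ≈ shift₂ 0 0 (λ p q → 1ℤ * Y S p q) ⊖ shift₂ 1 1 (λ p q → 1ℤ * Y S p q)
  coefficients S S≡T zero          zero    rewrite S≡T 0 = refl
  coefficients S S≡T zero          (suc j) = refl
  coefficients S S≡T (suc zero)    zero    rewrite S≡T 1 = first-column (a 0 0)
  coefficients S S≡T (suc (suc p)) zero    rewrite S≡T (suc (suc p)) = first-column (a (suc p) 0)
  coefficients S S≡T (suc zero) (suc zero) rewrite S≡T 0 | corner | above 0 1 (s≤s z≤n) = refl
  coefficients S S≡T (suc zero) (suc (suc m))
    rewrite above 0 (suc (suc m)) (s≤s z≤n) | above 0 (suc m) (s≤s z≤n) = refl
  coefficients S S≡T (suc (suc p)) (suc zero) rewrite S≡T (suc p) | column₀ p | ∧-zeroʳ (p ≡ᵇ 0) =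
    second-column (a p 0) (a (suc p) 1)
    where
    second-column : ∀ x y → (+ 2 * y - + 2 * (x + y)) + 0ℤ ≡ 0ℤ - 1ℤ * ((0ℤ - - (+ 2) * x) - 0ℤ)
    second-column = solve-∀
  coefficients S S≡T (suc (suc p)) (suc (suc m)) = begin
    (+ 2 * x - + 2 * y) + + 2 * z
      ≡⟨ interior-case x y z (δ p m) (row-recurrence p m) ⟩
    0ℤ - 1ℤ * (0ℤ - + 2 * δ p m)
      ≡⟨ cong (λ t → 0ℤ - 1ℤ * (0ℤ - t)) (sym (mono-unit (+ 2) p m)) ⟩
    0ℤ - 1ℤ * (0ℤ - mono (+ 2) 1 1 (suc p) (suc m)) ∎
    where
    x y z : ℤ
    x = a (suc p) (suc (suc m))
    y = a (suc p) (suc m)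
    z = a p m
    interior-case : ∀ x y z d → y + d ≡ z + x → (+ 2 * x - + 2 * y) + + 2 * z ≡ 0ℤ - 1ℤ * (0ℤ - + 2 * d)
    interior-case x y z d y+d≡z+x = begin
      (+ 2 * x - + 2 * y) + + 2 * z   ≡⟨ factor x y z ⟩
      + 2 * ((z + x) - y)             ≡⟨ cong (λ t → + 2 * (t - y)) (sym y+d≡z+x) ⟩
      + 2 * ((y + d) - y)             ≡⟨ unfactor y d ⟩
      0ℤ - 1ℤ * (0ℤ - + 2 * d) ∎
      where
      factor : ∀ x y z → (+ 2 * x - + 2 * y) + + 2 * z ≡ + 2 * ((z + x) - y)
      factor = solve-∀
      unfactor : ∀ y d → + 2 * ((y + d) - y) ≡ 0ℤ - 1ℤ * (0ℤ - + 2 * d)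
      unfactor = solve-∀

  generating-function : ∀ S → (∀ n → S n ≡ T n) → a ⊛ denom ≈ numer S
  generating-function S S≡T i j = begin
    (a ⊛ denom) i j
      ≡⟨ ⊛-comm a denom i j ⟩
    (denom ⊛ a) i j
      ≡⟨ denom-⊛ a i j ⟩
    (shift₂ 1 0 twoA ⊖ shift₂ 1 1 twoA ⊕ shift₂ 2 2 twoA) i j
      ≡⟨ coefficients S S≡T i j ⟩
    (shift₂ 0 0 (λ p q → 1ℤ * Y S p q) ⊖ shift₂ 1 1 (λ p q → 1ℤ * Y S p q)) i j
      ≡⟨ sym (numer-expand S i j) ⟩
    numer S i j ∎

theorem2 : (a : ℕ → ℕ → ℤ)
    → a 0 0 ≡ 1ℤ
    → (∀ n → a (suc n) (suc n) ≡ 0ℤ)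
    → (∀ n → a (suc n) 0 ≡ a n 0 + a (suc n) 1)
    → (∀ n m → m < n → a (suc n) (suc m) ≡ a n m + a (suc n) (suc (suc m)))
    → (∀ i j → i < j → a i j ≡ 0ℤ)
    → (∃ λ S → IsSqrt1m4x S)
      × (∀ S → IsSqrt1m4x S → a ⊛ denom ≈ numer S)
theorem2 a corner diagonal column₀ interior above =
  (T , T-is-root) , λ S S-is-root → generating-function S (S≡T S S-is-root)
  where
  open CatalanArray a corner diagonal column₀ interior above
  T-is-root : IsSqrt1m4x T
  T-is-root = catalan-sqrt A corner catalan
  S≡T : ∀ S → IsSqrt1m4x S → ∀ n → S n ≡ T n
  S≡T S (S₀≡1 , S²≡1-4x) = square-root-unique S T S₀≡1 refl
    (λ n → trans (S²≡1-4x n 0) (sym (proj₂ T-is-root n 0)))
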